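{- Let $G$ be a graph with $14$ vertices and let $u\in V(G)$ with $\deg_G(u)=6$. If $G$ is $3$-non-compliant, then $$\sum_{v\in N_G(u)}\deg_G(v)\ge 39.$$
   Context: All graphs are finite, simple and undirected; $\overline{G}$ denotes the complement of $G$; $N_G(u)$ is the set of vertices adjacent to $u$. A minor of $G$ is a graph obtained from $G$ by a sequence of vertex deletions, edge deletions and edge contractions. $\Delta(H)$ is the maximum degree of $H$. A graph $G$ on $n$ vertices is $3$-non-compliant if neither $G$ nor $\overline{G}$ has a minor $H$ with $\Delta(H)\ge n-3$. -}

module Defs where

open import Data.Nat using (ℕ; suc; _+_; _⊔_; _∸_; _≤_)
open import Data.Bool using (Bool; true; false; not; _∧_; _∨_; T; if_then_else_)
open import Data.Bool.Properties using (∨-comm)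
open import Data.Fin using (Fin; punchIn; _≟_)
open import Data.List using (List; map; foldr; allFin)
open import Data.Nat.ListAction using (sum)
open import Data.Product using (Σ; ∃; _×_; _,_)
open import Relation.Nullary using (¬_; yes; no; does)
open import Relation.Binary.PropositionalEquality using (_≡_; refl; sym; cong; cong₂)

record Graph (n : ℕ) : Set where
  field
    adj   : Fin n → Fin n → Bool
    adj-sym : ∀ i j → adj i j ≡ adj j i
    adj-irr : ∀ i → adj i i ≡ false
open Graph public

_==_ : ∀ {n} → Fin n → Fin n → Bool
i == j = does (i ≟ j)

==-sym : ∀ {n} (i j : Fin n) → (i == j) ≡ (j == i)
==-sym i j with i ≟ j | j ≟ i
... | yes _ | yes _ = refl
... | no _  | no _  = refl
... | yes p | no q  with q (sym p)
... | ()
==-sym i j | no p | yes q with p (sym q)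
... | ()

==-refl : ∀ {n} (i : Fin n) → (i == i) ≡ true
==-refl i with i ≟ i
... | yes _ = refl
... | no p with p refl
... | ()

mkGraph : ∀ {n} → (Fin n → Fin n → Bool) → Graph n
mkGraph r = record
  { adj = λ i j → not (i == j) ∧ (r i j ∨ r j i)
  ; adj-sym = λ i j → cong₂ _∧_ (cong not (==-sym i j)) (∨-comm (r i j) (r j i))
  ; adj-irr = λ i → cong (λ a → not a ∧ (r i i ∨ r i i)) (==-refl i)
  }

complement : ∀ {n} → Graph n → Graph n
complement G = mkGraph (λ i j → not (adj G i j))

deg : ∀ {n} → Graph n → Fin n → ℕ
deg {n} G u = sum (map (λ j → if adj G u j then 1 else 0) (allFin n))

Δ : ∀ {n} → Graph n → ℕ
Δ {n} G = foldr _⊔_ 0 (map (deg G) (allFin n))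

nbrDegSum : ∀ {n} → Graph n → Fin n → ℕ
nbrDegSum {n} G u = sum (map (λ j → if adj G u j then deg G j else 0) (allFin n))

deleteVertex : ∀ {n} → Graph (suc n) → Fin (suc n) → Graph n
deleteVertex G v = record
  { adj = λ i j → adj G (punchIn v i) (punchIn v j)
  ; adj-sym = λ i j → adj-sym G (punchIn v i) (punchIn v j)
  ; adj-irr = λ i → adj-irr G (punchIn v i)
  }

-- Edge contraction of the edge uv (v is merged into u; the merged vertex is
-- adjacent to N(u) ∪ N(v) minus itself).
contract : ∀ {n} → Graph (suc n) → (u v : Fin (suc n)) → Graph n
contract G u v = mkGraph (λ i j →
  adj G (punchIn v i) (punchIn v j) ∨ ((punchIn v i == u) ∧ adj G v (punchIn v j)))

-- H is a spanning subgraph of G (result of a sequence of edge deletions).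
_⊆ᴱ_ : ∀ {n} → Graph n → Graph n → Set
H ⊆ᴱ G = ∀ i j → T (adj H i j) → T (adj G i j)

data Minor {n : ℕ} (G : Graph n) : (m : ℕ) → Graph m → Set where
  here     : Minor G n G
  delVertex : ∀ {m} {H : Graph (suc m)} → Minor G (suc m) H →
              (v : Fin (suc m)) → Minor G m (deleteVertex H v)
  delEdges : ∀ {m} {H : Graph m} → Minor G m H →
              (H' : Graph m) → H' ⊆ᴱ H → Minor G m H'
  contractEdge : ∀ {m} {H : Graph (suc m)} → Minor G (suc m) H →
              (u v : Fin (suc m)) → T (adj H u v) → Minor G m (contract H u v)

HasMinorΔ≥ : ∀ {n} → Graph n → ℕ → Set
HasMinorΔ≥ G k = Σ ℕ λ m → Σ (Graph _) λ H → Minor G m H × k ≤ Δ H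

NonCompliant3 : ∀ {n} → Graph n → Set
NonCompliant3 {n} G = ¬ HasMinorΔ≥ G (n ∸ 3) × ¬ HasMinorΔ≥ (complement G) (n ∸ 3)

{-# OPTIONS --safe #-}
-- Write N for the neighbours of u and M for the other vertices not adjacent to u, so
-- that |N| + |M| = n - 1 on n vertices.  Contracting both edges of a path q - p - r gives a
-- minor in which the merged vertex is adjacent to every vertex outside {p, q, r} that is
-- adjacent to one of them, so non-compliance bounds that set by n - 4, in G and in its
-- complement.  Paths through u then give
--   (I) any two vertices a, b of N have a common non-neighbour in M   (a - u - b in G),
--   (A) any two vertices w, w′ of M have a common neighbour in N      (w - u - w′ in Gᶜ),
--   (B) v ∈ N and a non-neighbour w ∈ M of v have a common neighbour in N
--                                                                     (u - w - v in Gᶜ).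
-- If w ∈ M had at most two neighbours in N, (I) would give w′ ∈ M missing all of them,
-- against (A); if v ∈ N had at most one neighbour in N, (I) would give w ∈ M missing v
-- and that neighbour, against (B).  So every vertex of M has at least 3 neighbours in N,
-- every v ∈ N is adjacent to u and to at least 2 vertices of N, and double counting the
-- N–M edges gives  Σ_{v ∈ N} deg v ≥ 3|N| + 3|M| = 3(n - 1),  whatever the degree of u.
module Submission where

open import Defs
open import Data.Nat.Properties hiding (_≟_)
open import Algebra.Properties.Semiring.Sum +-*-semiring
  using (sum-syntax; sum-cong-≗; sum-remove; sum-replicate-zero; ∑-comm; ∑-distrib-+; *-distribˡ-sum)
open import Data.Bool using (true; false; _∧_; T; if_then_else_)
open import Data.Bool.Properties using (T?; T-∨; ∧-zeroʳ)
open import Data.Empty using (⊥-elim)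
open import Data.Fin using (Fin; zero; suc; punchIn; punchOut; _≟_)
open import Data.Fin.Properties using (any?; punchInᵢ≢i; punchIn-punchOut)
open import Data.List using (tabulate; allFin; map)
open import Data.List.Properties using (map-tabulate; foldr-preservesᵒ)
open import Data.List.Membership.Propositional.Properties using (∈-map⁺; ∈-allFin)
import Data.List.Relation.Unary.Any as Any
import Data.Nat.ListAction as List
open import Data.Nat using (ℕ; _∸_; zero; suc; _+_; _*_; _≤_; _<_; _≤?_; z≤n; s≤s; s≤s⁻¹; z<s)
open import Data.Product using (∃; ∃₂; _×_; _,_; proj₁; proj₂)
open import Data.Sum using (_⊎_; inj₁; inj₂; [_,_])
open import Data.Unit using (tt)
open import Function using (_∘_; id; case_of_)
open import Function.Bundles using (Equivalence)
open import Level using (Level; 0ℓ)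
open import Relation.Nullary using (¬_; Dec; yes; no; does; contradiction)
open import Relation.Unary
  using (Pred; Decidable; _∈_; _∉_; _⊆_; _∩_; _∪_; _∖_; ∁; ｛_｝; Empty; Satisfiable; _⊥_)
open import Relation.Unary.Properties using (_∩?_; _∪?_; ∁?)
open import Relation.Binary.PropositionalEquality
  using (_≡_; _≢_; refl; sym; trans; cong; cong₂; subst; subst₂; module ≡-Reasoning)

private
  variable
    n : ℕ
    ℓ ℓ₁ ℓ₂ ℓ₃ : Level

-- Counting the elements of decidable sets of vertices

infixl 6 _-_ _-?_ _∖?_

_∖?_ : {P : Pred (Fin n) ℓ₁} {Q : Pred (Fin n) ℓ₂} → Decidable P → Decidable Q → Decidable (P ∖ Q)
P? ∖? Q? = P? ∩? ∁? Q?

_-_ : Pred (Fin n) ℓ → Fin n → Pred (Fin n) ℓ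
P - a = P ∖ ｛ a ｝

_-?_ : {P : Pred (Fin n) ℓ} → Decidable P → (a : Fin n) → Decidable (P - a)
P? -? a = P? ∖? (a ≟_)

[_]⟨_⟩ : {A : Set ℓ} → Dec A → ℕ → ℕ
[ a? ]⟨ x ⟩ = if does a? then x else 0

[]⟨⟩-mono : {A : Set ℓ} (a? : Dec A) {x y : ℕ} → (A → x ≤ y) → [ a? ]⟨ x ⟩ ≤ [ a? ]⟨ y ⟩
[]⟨⟩-mono (yes a) x≤y = x≤y a
[]⟨⟩-mono (no  _) _   = z≤n

[]⟨⟩-+-mono : {A : Set ℓ} (a? : Dec A) {x y z : ℕ} → (A → x + y ≤ z) →
              [ a? ]⟨ x ⟩ + [ a? ]⟨ y ⟩ ≤ [ a? ]⟨ z ⟩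
[]⟨⟩-+-mono (yes a) x+y≤z = x+y≤z a
[]⟨⟩-+-mono (no  _) _     = z≤n

count : {P : Pred (Fin n) ℓ} → Decidable P → ℕ
count {n} P? = ∑[ i < n ] [ P? i ]⟨ 1 ⟩

∑-mono-≤ : {f g : Fin n → ℕ} → (∀ i → f i ≤ g i) → ∑[ i < n ] f i ≤ ∑[ i < n ] g i
∑-mono-≤ {zero}  f≤g = z≤n
∑-mono-≤ {suc n} f≤g = +-mono-≤ (f≤g zero) (∑-mono-≤ (f≤g ∘ suc))

∑-[]⟨⟩-const : {P : Pred (Fin n) ℓ} (P? : Decidable P) (c : ℕ) →
               ∑[ i < n ] [ P? i ]⟨ c ⟩ ≡ c * count P?
∑-[]⟨⟩-const P? c = sym (trans (*-distribˡ-sum c (λ i → [ P? i ]⟨ 1 ⟩)) (sum-cong-≗ scale))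
  where
  scale : ∀ i → c * [ P? i ]⟨ 1 ⟩ ≡ [ P? i ]⟨ c ⟩
  scale i with P? i
  ... | yes _ = *-identityʳ c
  ... | no  _ = *-zeroʳ c

count-mono : {P : Pred (Fin n) ℓ₁} {Q : Pred (Fin n) ℓ₂} (P? : Decidable P) (Q? : Decidable Q) →
             P ⊆ Q → count P? ≤ count Q?
count-mono P? Q? P⊆Q = ∑-mono-≤ indicator-mono
  where
  indicator-mono : ∀ i → [ P? i ]⟨ 1 ⟩ ≤ [ Q? i ]⟨ 1 ⟩
  indicator-mono i with P? i | Q? i
  ... | yes _   | yes _   = ≤-refl
  ... | yes i∈P | no  i∉Q = contradiction (P⊆Q i∈P) i∉Q
  ... | no  _   | _       = z≤n

count-disjoint : {P : Pred (Fin n) ℓ₁} {Q : Pred (Fin n) ℓ₂} {R : Pred (Fin n) ℓ₃}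
                 (P? : Decidable P) (Q? : Decidable Q) (R? : Decidable R) →
                 P ⊆ R → Q ⊆ R → P ⊥ Q → count P? + count Q? ≤ count R?
count-disjoint {n} P? Q? R? P⊆R Q⊆R P⊥Q = begin
  count P? + count Q?                          ≡⟨ ∑-distrib-+ (λ i → [ P? i ]⟨ 1 ⟩) (λ i → [ Q? i ]⟨ 1 ⟩) ⟨
  ∑[ i < n ] ([ P? i ]⟨ 1 ⟩ + [ Q? i ]⟨ 1 ⟩)  ≤⟨ ∑-mono-≤ indicators ⟩
  count R?                                     ∎
  where
  open ≤-Reasoning
  indicators : ∀ i → [ P? i ]⟨ 1 ⟩ + [ Q? i ]⟨ 1 ⟩ ≤ [ R? i ]⟨ 1 ⟩
  indicators i with P? i | Q? i | R? i
  ... | yes i∈P | yes i∈Q | _       = ⊥-elim (P⊥Q (i∈P , i∈Q))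
  ... | yes _   | no  _   | yes _   = ≤-refl
  ... | yes i∈P | no  _   | no  i∉R = contradiction (P⊆R i∈P) i∉R
  ... | no  _   | yes _   | yes _   = ≤-refl
  ... | no  _   | yes i∈Q | no  i∉R = contradiction (Q⊆R i∈Q) i∉R
  ... | no  _   | no  _   | _       = z≤n

count≡0 : {P : Pred (Fin n) ℓ} (P? : Decidable P) → Empty P → count P? ≡ 0
count≡0 {n} P? P=∅ = trans (sum-cong-≗ indicator≡0) (sum-replicate-zero n)
  where
  indicator≡0 : ∀ i → [ P? i ]⟨ 1 ⟩ ≡ 0
  indicator≡0 i with P? i
  ... | yes i∈P = contradiction i∈P (P=∅ i)
  ... | no  _   = refl

count-punchIn : {P : Pred (Fin (suc n)) ℓ} (P? : Decidable P) {a : Fin (suc n)} →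
                a ∉ P → count P? ≡ count (P? ∘ punchIn a)
count-punchIn P? {a} a∉P with P? a | sum-remove {i = a} (λ i → [ P? i ]⟨ 1 ⟩)
... | yes a∈P | _     = contradiction a∈P a∉P
... | no  _   | split = split

count-remove : {P : Pred (Fin (suc n)) ℓ} (P? : Decidable P) {a : Fin (suc n)} →
               a ∈ P → count P? ≡ suc (count (P? -? a))
count-remove P? {a} a∈P with P? a | sum-remove {i = a} (λ i → [ P? i ]⟨ 1 ⟩)
... | no  a∉P | _     = contradiction a∈P a∉P
... | yes _   | split = begin
  count P?                             ≡⟨ split ⟩
  suc (count (P? ∘ punchIn a))         ≡⟨ cong suc (sum-cong-≗ same) ⟩
  suc (count ((P? -? a) ∘ punchIn a))  ≡⟨ cong suc (count-punchIn (P? -? a) (λ (_ , a≢a) → a≢a refl)) ⟨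
  suc (count (P? -? a))                ∎
  where
  open ≡-Reasoning
  same : ∀ i → [ P? (punchIn a i) ]⟨ 1 ⟩ ≡ [ (P? -? a) (punchIn a i) ]⟨ 1 ⟩
  same i with a ≟ punchIn a i
  ... | yes a≡i = contradiction (sym a≡i) (punchInᵢ≢i a i)
  ... | no  _   with P? (punchIn a i)
  ...   | yes _ = refl
  ...   | no  _ = refl

count-remove₂ : {P : Pred (Fin (suc n)) ℓ} (P? : Decidable P) {a b : Fin (suc n)} →
                a ∈ P → b ∈ P → a ≢ b → count P? ≡ 2 + count (P? -? a -? b)
count-remove₂ P? a∈P b∈P a≢b =
  trans (count-remove P? a∈P) (cong suc (count-remove (P? -? _) (b∈P , a≢b)))

count-complement : {P : Pred (Fin n) ℓ} (P? : Decidable P) → count P? + count (∁? P?) ≡ n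
count-complement {zero}  P? = refl
count-complement {suc n} P? with P? zero
... | yes _ = cong suc (count-complement (P? ∘ suc))
... | no  _ = trans (+-suc _ _) (cong suc (count-complement (P? ∘ suc)))

count-witness : {P : Pred (Fin n) ℓ} (P? : Decidable P) → 0 < count P? → Satisfiable P
count-witness P? 0<|P| with any? P?
... | yes P≠∅ = P≠∅
... | no  P=∅ = contradiction (count≡0 P? (λ i i∈P → P=∅ (i , i∈P))) (>⇒≢ 0<|P|)

count-pos : {P : Pred (Fin (suc n)) ℓ} (P? : Decidable P) {a : Fin (suc n)} → a ∈ P → 0 < count P?
count-pos P? a∈P = subst (0 <_) (sym (count-remove P? a∈P)) z<s

removal-shrinking : {P : Pred (Fin (suc n)) ℓ₁} {Q : Pred (Fin (suc n)) ℓ₂}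
                    (P? : Decidable P) (Q? : Decidable Q) {k : ℕ} →
                    P ⊆ Q → count P? ≤ suc k → 0 < count Q? → ∃ λ a → a ∈ Q × count (P? -? a) ≤ k
removal-shrinking P? Q? {k} P⊆Q |P|≤1+k 0<|Q| with any? P? | count-witness Q? 0<|Q|
... | yes (a , a∈P) | _         = a , P⊆Q a∈P , s≤s⁻¹ (subst (_≤ suc k) (count-remove P? a∈P) |P|≤1+k)
... | no  P=∅       | (a , a∈Q) =
  a , a∈Q , subst (_≤ k) (sym (count≡0 (P? -? a) (λ i (i∈P , _) → P=∅ (i , i∈P)))) z≤n

count[P-a-b]≤0⇒P⊆ab : {P : Pred (Fin (suc n)) ℓ} (P? : Decidable P) {a b : Fin (suc n)} →
                      count (P? -? a -? b) ≤ 0 → P ⊆ ｛ a ｝ ∪ ｛ b ｝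
count[P-a-b]≤0⇒P⊆ab P? {a} {b} |P-a-b|≤0 {i} i∈P with a ≟ i | b ≟ i
... | yes a≡i | _       = inj₁ a≡i
... | no  _   | yes b≡i = inj₂ b≡i
... | no  a≢i | no  b≢i = contradiction (count-pos (P? -? a -? b) ((i∈P , a≢i) , b≢i)) (≤⇒≯ |P-a-b|≤0)

⊆-pair : {P : Pred (Fin (suc n)) ℓ₁} {Q : Pred (Fin (suc n)) ℓ₂} (P? : Decidable P) (Q? : Decidable Q) →
         P ⊆ Q → count P? ≤ 2 → 2 ≤ count Q? →
         ∃₂ λ a b → a ∈ Q × b ∈ Q × a ≢ b × P ⊆ ｛ a ｝ ∪ ｛ b ｝
⊆-pair P? Q? P⊆Q |P|≤2 2≤|Q| with removal-shrinking P? Q? P⊆Q |P|≤2 (≤-trans (n≤1+n 1) 2≤|Q|)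
... | a , a∈Q , |P-a|≤1 with removal-shrinking (P? -? a) (Q? -? a) (λ (i∈P , a≢i) → P⊆Q i∈P , a≢i) |P-a|≤1
                                                (s≤s⁻¹ (subst (2 ≤_) (count-remove Q? a∈Q) 2≤|Q|))
...   | b , (b∈Q , a≢b) , |P-a-b|≤0 = a , b , a∈Q , b∈Q , a≢b , count[P-a-b]≤0⇒P⊆ab P? |P-a-b|≤0

-- Neighbourhoods, degrees and the complement

Nbr : Graph n → Fin n → Pred (Fin n) 0ℓ
Nbr G v w = T (adj G v w)

nbr? : (G : Graph n) (v : Fin n) → Decidable (Nbr G v)
nbr? G v w = T? (adj G v w)

Nbr-sym : (G : Graph n) {v w : Fin n} → w ∈ Nbr G v → v ∈ Nbr G w
Nbr-sym G {v} {w} = subst T (adj-sym G v w)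

Nbr-irrefl : (G : Graph n) {v w : Fin n} → w ∈ Nbr G v → v ≢ w
Nbr-irrefl G {v} w∈N refl = subst T (adj-irr G v) w∈N

complement-Nbr⁺ : (G : Graph n) {v w : Fin n} → v ≢ w → w ∉ Nbr G v → w ∈ Nbr (complement G) v
complement-Nbr⁺ G {v} {w} v≢w w∉N with v ≟ w | adj G v w
... | yes v≡w | _     = contradiction v≡w v≢w
... | no  _   | true  = contradiction tt w∉N
... | no  _   | false = tt

complement-Nbr⁻ : (G : Graph n) {v w : Fin n} → w ∈ Nbr (complement G) v → w ∉ Nbr G v
complement-Nbr⁻ G {v} {w} w∈Nᶜ w∈N with v ≟ w | adj G v w | adj G w v | adj-sym G v w
complement-Nbr⁻ G () _ | yes _ | _     | _    | _
complement-Nbr⁻ G () _ | no  _ | true  | true | _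
complement-Nbr⁻ G _ () | no  _ | false | _    | _

sum-tabulate : (f : Fin n → ℕ) → List.sum (tabulate f) ≡ ∑[ i < n ] f i
sum-tabulate {zero}  f = refl
sum-tabulate {suc n} f = cong (f zero +_) (sum-tabulate (f ∘ suc))

sum-map-allFin : (f : Fin n → ℕ) → List.sum (map f (allFin n)) ≡ ∑[ i < n ] f i
sum-map-allFin f = trans (cong List.sum (map-tabulate id f)) (sum-tabulate f)

deg≡count : (G : Graph n) (v : Fin n) → deg G v ≡ count (nbr? G v)
deg≡count G v = sum-map-allFin (λ w → [ nbr? G v w ]⟨ 1 ⟩)

nbrDegSum≡∑ : (G : Graph n) (u : Fin n) → nbrDegSum G u ≡ ∑[ v < n ] [ nbr? G u v ]⟨ deg G v ⟩
nbrDegSum≡∑ G u = sum-map-allFin (λ v → [ nbr? G u v ]⟨ deg G v ⟩)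

deg≤Δ : (G : Graph n) (v : Fin n) → deg G v ≤ Δ G
deg≤Δ {n} G v =
  foldr-preservesᵒ (λ x y → [ m≤n⇒m≤n⊔o y , m≤n⇒m≤o⊔n x ]) 0 (map (deg G) (allFin n))
  (inj₂ (Any.map ≤-reflexive (∈-map⁺ (deg G) (∈-allFin v))))

edges-between : (G : Graph n) {P : Pred (Fin n) ℓ₁} {Q : Pred (Fin n) ℓ₂}
                (P? : Decidable P) (Q? : Decidable Q) →
                ∑[ v < n ] [ P? v ]⟨ count (Q? ∩? nbr? G v) ⟩ ≡
                ∑[ w < n ] [ Q? w ]⟨ count (P? ∩? nbr? G w) ⟩
edges-between {n} G P? Q? = begin
  ∑[ v < n ] [ P? v ]⟨ count (Q? ∩? nbr? G v) ⟩  ≡⟨ sum-cong-≗ from-P ⟩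
  ∑[ v < n ] ∑[ w < n ] edge v w                 ≡⟨ ∑-comm edge ⟩
  ∑[ w < n ] ∑[ v < n ] edge v w                 ≡⟨ sum-cong-≗ to-Q ⟩
  ∑[ w < n ] [ Q? w ]⟨ count (P? ∩? nbr? G w) ⟩  ∎
  where
  open ≡-Reasoning
  edge : Fin n → Fin n → ℕ
  edge v w = if does (P? v) ∧ (does (Q? w) ∧ adj G v w) then 1 else 0
  from-P : ∀ v → [ P? v ]⟨ count (Q? ∩? nbr? G v) ⟩ ≡ ∑[ w < n ] edge v w
  from-P v with does (P? v)
  ... | true  = refl
  ... | false = sym (sum-replicate-zero n)
  to-Q : ∀ w → ∑[ v < n ] edge v w ≡ [ Q? w ]⟨ count (P? ∩? nbr? G w) ⟩
  to-Q w with does (Q? w)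
  ... | true  = sum-cong-≗ (λ v → cong (λ b → if does (P? v) ∧ b then 1 else 0) (adj-sym G v w))
  ... | false = trans (sum-cong-≗ (λ v → cong (λ b → if b then 1 else 0) (∧-zeroʳ (does (P? v)))))
                      (sum-replicate-zero n)

-- Contracting the two edges of a cherry

Nbr₂ : Graph n → Fin n → Fin n → Pred (Fin n) 0ℓ
Nbr₂ K p q = (Nbr K p ∪ Nbr K q) ∖ (｛ p ｝ ∪ ｛ q ｝)

nbr₂? : (K : Graph n) (p q : Fin n) → Decidable (Nbr₂ K p q)
nbr₂? K p q = (nbr? K p ∪? nbr? K q) ∖? ((p ≟_) ∪? (q ≟_))

Nbr₃ : Graph n → Fin n → Fin n → Fin n → Pred (Fin n) 0ℓ
Nbr₃ K p q r = (Nbr K p ∪ Nbr K q ∪ Nbr K r) ∖ (｛ p ｝ ∪ ｛ q ｝ ∪ ｛ r ｝)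

nbr₃? : (K : Graph n) (p q r : Fin n) → Decidable (Nbr₃ K p q r)
nbr₃? K p q r = (nbr? K p ∪? nbr? K q ∪? nbr? K r) ∖? ((p ≟_) ∪? (q ≟_) ∪? (r ≟_))

contract-Nbr-kept : (K : Graph (suc n)) (p q : Fin (suc n)) {i j : Fin n} →
                    punchIn q j ∈ Nbr K (punchIn q i) → j ∈ Nbr (contract K p q) i
contract-Nbr-kept K p q {i} {j} j∈N with i ≟ j
... | yes i≡j = contradiction (cong (punchIn q) i≡j) (Nbr-irrefl K j∈N)
... | no  _   = Equivalence.from T-∨ (inj₁ (Equivalence.from T-∨ (inj₁ j∈N)))

contract-Nbr-merged : (K : Graph (suc n)) (p q : Fin (suc n)) {i j : Fin n} → punchIn q i ≡ p → i ≢ j →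
                      punchIn q j ∈ Nbr K p ∪ Nbr K q → j ∈ Nbr (contract K p q) i
contract-Nbr-merged K p q refl _ (inj₁ j∈Np) = contract-Nbr-kept K p q j∈Np
contract-Nbr-merged K p q {i} {j} refl i≢j (inj₂ j∈Nq) with i ≟ j | punchIn q i ≟ punchIn q i
... | yes i≡j | _      = contradiction i≡j i≢j
... | no  _   | no ≢pi = contradiction refl ≢pi
... | no  _   | yes _  =
  Equivalence.from T-∨ (inj₁ (Equivalence.from (T-∨ {adj K (punchIn q i) (punchIn q j)}) (inj₂ j∈Nq)))

count-Nbr₂≤deg-contract : (K : Graph (suc n)) {p q : Fin (suc n)} (q≢p : q ≢ p) →
                          count (nbr₂? K p q) ≤ deg (contract K p q) (punchOut q≢p)
count-Nbr₂≤deg-contract K {p} {q} q≢p = begin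
  count (nbr₂? K p q)              ≡⟨ count-punchIn (nbr₂? K p q) (λ (_ , q∉pq) → q∉pq (inj₂ refl)) ⟩
  count (nbr₂? K p q ∘ punchIn q)  ≤⟨ count-mono (nbr₂? K p q ∘ punchIn q) (nbr? H p₁) adjacent ⟩
  count (nbr? H p₁)                ≡⟨ deg≡count H p₁ ⟨
  deg H p₁                         ∎
  where
  open ≤-Reasoning
  H = contract K p q
  p₁ = punchOut q≢p
  adjacent : ∀ {y} → punchIn q y ∈ Nbr₂ K p q → y ∈ Nbr H p₁
  adjacent (y∈N , y∉pq) = contract-Nbr-merged K p q (punchIn-punchOut q≢p)
    (λ p₁≡y → y∉pq (inj₁ (trans (sym (punchIn-punchOut q≢p)) (cong (punchIn q) p₁≡y)))) y∈N

Nbr₃⊆Nbr₂-contract : (K : Graph (suc n)) {p q r : Fin (suc n)} (q≢p : q ≢ p) (q≢r : q ≢ r) →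
                     Nbr₃ K p q r ∘ punchIn q ⊆ Nbr₂ (contract K p q) (punchOut q≢p) (punchOut q≢r)
Nbr₃⊆Nbr₂-contract K {p} {q} {r} q≢p q≢r {y} (y∈N , y∉pqr) = adjacent y∈N , distinct
  where
  p₁≢y : punchOut q≢p ≢ y
  p₁≢y p₁≡y = y∉pqr (inj₁ (trans (sym (punchIn-punchOut q≢p)) (cong (punchIn q) p₁≡y)))
  adjacent : punchIn q y ∈ Nbr K p ∪ Nbr K q ∪ Nbr K r →
             y ∈ Nbr (contract K p q) (punchOut q≢p) ∪ Nbr (contract K p q) (punchOut q≢r)
  adjacent (inj₁ y∈Np)        = inj₁ (contract-Nbr-merged K p q (punchIn-punchOut q≢p) p₁≢y (inj₁ y∈Np))
  adjacent (inj₂ (inj₁ y∈Nq)) = inj₁ (contract-Nbr-merged K p q (punchIn-punchOut q≢p) p₁≢y (inj₂ y∈Nq))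
  adjacent (inj₂ (inj₂ y∈Nr)) =
    inj₂ (contract-Nbr-kept K p q (subst (λ x → punchIn q y ∈ Nbr K x) (sym (punchIn-punchOut q≢r)) y∈Nr))
  distinct : ¬ (punchOut q≢p ≡ y ⊎ punchOut q≢r ≡ y)
  distinct (inj₁ p₁≡y) = p₁≢y p₁≡y
  distinct (inj₂ r₁≡y) = y∉pqr (inj₂ (inj₂ (trans (sym (punchIn-punchOut q≢r)) (cong (punchIn q) r₁≡y))))

cherry-minor : (K : Graph (suc n)) {p q r : Fin (suc n)} → q ∈ Nbr K p → r ∈ Nbr K p → q ≢ r →
               HasMinorΔ≥ K (count (nbr₃? K p q r))
cherry-minor {zero}  K {zero} {zero} q∈Np _ _ = contradiction refl (Nbr-irrefl K q∈Np)
cherry-minor {suc n} K {p} {q} {r} q∈Np r∈Np q≢r =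
  n , H₂ , contractEdge (contractEdge here p q q∈Np) p₁ r₁ r₁∈Np₁ , bound
  where
  q≢p : q ≢ p
  q≢p q≡p = Nbr-irrefl K q∈Np (sym q≡p)
  H₁ = contract K p q
  p₁ = punchOut q≢p
  r₁ = punchOut q≢r
  r₁∈Np₁ : r₁ ∈ Nbr H₁ p₁
  r₁∈Np₁ = contract-Nbr-kept K p q
    (subst₂ (λ a b → b ∈ Nbr K a) (sym (punchIn-punchOut q≢p)) (sym (punchIn-punchOut q≢r)) r∈Np)
  r₁≢p₁ : r₁ ≢ p₁
  r₁≢p₁ r₁≡p₁ = Nbr-irrefl H₁ r₁∈Np₁ (sym r₁≡p₁)
  H₂ = contract H₁ p₁ r₁
  bound : count (nbr₃? K p q r) ≤ Δ H₂
  bound = begin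
    count (nbr₃? K p q r)             ≡⟨ count-punchIn (nbr₃? K p q r)
                                                       (λ (_ , q∉pqr) → q∉pqr (inj₂ (inj₁ refl))) ⟩
    count (nbr₃? K p q r ∘ punchIn q) ≤⟨ count-mono (nbr₃? K p q r ∘ punchIn q) (nbr₂? H₁ p₁ r₁)
                                                    (Nbr₃⊆Nbr₂-contract K q≢p q≢r) ⟩
    count (nbr₂? H₁ p₁ r₁)            ≤⟨ count-Nbr₂≤deg-contract H₁ r₁≢p₁ ⟩
    deg H₂ (punchOut r₁≢p₁)           ≤⟨ deg≤Δ H₂ _ ⟩
    Δ H₂                              ∎
    where open ≤-Reasoning

non-compliant-bound : {K : Graph n} {d : ℕ} → ¬ HasMinorΔ≥ K (n ∸ 3) → HasMinorΔ≥ K d → 3 + d < n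
non-compliant-bound {n} ¬big (m , H , H≼K , d≤Δ) =
  ≰⇒> (λ n≤3+d → ¬big (m , H , H≼K , ≤-trans (m≤n+o⇒m∸n≤o n 3 n≤3+d) d≤Δ))

degree-bound : (K : Graph (suc n)) → ¬ HasMinorΔ≥ K (suc n ∸ 3) → (v : Fin (suc n)) → 3 + deg K v ≤ n
degree-bound K ¬big v = s≤s⁻¹ (non-compliant-bound ¬big (_ , K , here , deg≤Δ K v))

cherry-bound : (K : Graph (suc n)) → ¬ HasMinorΔ≥ K (suc n ∸ 3) → {p q r : Fin (suc n)} →
               q ∈ Nbr K p → r ∈ Nbr K p → q ≢ r → 3 + count (nbr₃? K p q r) ≤ n
cherry-bound K ¬big q∈Np r∈Np q≢r =
  s≤s⁻¹ (non-compliant-bound ¬big (cherry-minor K q∈Np r∈Np q≢r))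

-- The neighbourhood of a vertex in a 3-non-compliant graph

module _ {n : ℕ} (G : Graph (suc n)) (nc : NonCompliant3 G) (u : Fin (suc n)) where

  private
    Gᶜ = complement G
    N M : Pred (Fin (suc n)) 0ℓ
    N = Nbr G u
    M = Nbr Gᶜ u
    N? : Decidable N
    N? = nbr? G u
    M? : Decidable M
    M? = nbr? Gᶜ u

  N⊥M : N ⊥ M
  N⊥M (w∈N , w∈M) = complement-Nbr⁻ G w∈M w∈N

  u≢N : ∀ {w} → w ∈ N → u ≢ w
  u≢N = Nbr-irrefl G

  u≢M : ∀ {w} → w ∈ M → u ≢ w
  u≢M = Nbr-irrefl Gᶜ

  N≢M : ∀ {v w} → v ∈ N → w ∈ M → v ≢ w
  N≢M v∈N w∈M refl = N⊥M (v∈N , w∈M)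

  M≢N : ∀ {w v} → w ∈ M → v ∈ N → w ≢ v
  M≢N w∈M v∈N refl = N⊥M (v∈N , w∈M)

  n≤|N|+|M| : n ≤ count N? + count M?
  n≤|N|+|M| = s≤s⁻¹ (begin
    suc n                               ≡⟨ count-complement N? ⟨
    count N? + count (∁? N?)            ≡⟨ cong (count N? +_) (count-remove (∁? N?) (λ u∈N → u≢N u∈N refl)) ⟩
    count N? + suc (count (∁? N? -? u)) ≤⟨ +-monoʳ-≤ (count N?) (s≤s (count-mono (∁? N? -? u) M? non-nbr)) ⟩
    count N? + suc (count M?)           ≡⟨ +-suc (count N?) (count M?) ⟩
    suc (count N? + count M?)           ∎)
    where
    open ≤-Reasoning
    non-nbr : ∁ N - u ⊆ M
    non-nbr (w∉N , u≢w) = complement-Nbr⁺ G u≢w w∉N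

  3≤|N| : 3 ≤ count N?
  3≤|N| = +-cancelʳ-≤ (count M?) 3 (count N?) (begin
    3 + count M?        ≡⟨ cong (3 +_) (deg≡count Gᶜ u) ⟨
    3 + deg Gᶜ u        ≤⟨ degree-bound Gᶜ (proj₂ nc) u ⟩
    n                   ≤⟨ n≤|N|+|M| ⟩
    count N? + count M? ∎)
    where open ≤-Reasoning

  3≤|M| : 3 ≤ count M?
  3≤|M| = +-cancelˡ-≤ (count N?) 3 (count M?) (begin
    count N? + 3        ≡⟨ +-comm (count N?) 3 ⟩
    3 + count N?        ≡⟨ cong (3 +_) (deg≡count G u) ⟨
    3 + deg G u         ≤⟨ degree-bound G (proj₁ nc) u ⟩
    n                   ≤⟨ n≤|N|+|M| ⟩
    count N? + count M? ∎)
    where open ≤-Reasoning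

  N-pair-common-non-neighbour : ∀ {a b} → a ∈ N → b ∈ N → a ≢ b →
                                ∃ λ w → w ∈ M × w ∉ Nbr G a × w ∉ Nbr G b
  N-pair-common-non-neighbour {a} {b} a∈N b∈N a≢b with any? (M? ∩? ∁? (nbr? G a) ∩? ∁? (nbr? G b))
  ... | yes found = found
  ... | no  none  = ⊥-elim (<-irrefl refl (≤-trans (cherry-bound G (proj₁ nc) a∈N b∈N a≢b) large))
    where
    N-covered : N - a - b ⊆ Nbr₃ G u a b
    N-covered ((w∈N , a≢w) , b≢w) = inj₁ w∈N , [ u≢N w∈N , [ a≢w , b≢w ] ]
    disjoint : N - a - b ⊥ M
    disjoint (((w∈N , _) , _) , w∈M) = N⊥M (w∈N , w∈M)
    M-covered : M ⊆ Nbr₃ G u a b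
    M-covered {w} w∈M = inj₂ a-or-b , [ u≢M w∈M , [ N≢M a∈N w∈M , N≢M b∈N w∈M ] ]
      where
      a-or-b : w ∈ Nbr G a ⊎ w ∈ Nbr G b
      a-or-b with nbr? G a w | nbr? G b w
      ... | yes w∈Na | _        = inj₁ w∈Na
      ... | no  _    | yes w∈Nb = inj₂ w∈Nb
      ... | no  w∉Na | no  w∉Nb = contradiction (w , w∈M , w∉Na , w∉Nb) none
    large : n ≤ 2 + count (nbr₃? G u a b)
    large = begin
      n                                      ≤⟨ n≤|N|+|M| ⟩
      count N? + count M?                    ≡⟨ cong (_+ count M?) (count-remove₂ N? a∈N b∈N a≢b) ⟩
      2 + (count (N? -? a -? b) + count M?)  ≤⟨ +-monoʳ-≤ 2 (count-disjoint (N? -? a -? b) M? (nbr₃? G u a b)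
                                                                            N-covered M-covered disjoint) ⟩
      2 + count (nbr₃? G u a b)              ∎
      where open ≤-Reasoning

  M-pair-common-neighbour : ∀ {w w′} → w ∈ M → w′ ∈ M → w ≢ w′ →
                            ∃ λ z → z ∈ N × z ∈ Nbr G w × z ∈ Nbr G w′
  M-pair-common-neighbour {w} {w′} w∈M w′∈M w≢w′ with any? (N? ∩? nbr? G w ∩? nbr? G w′)
  ... | yes found = found
  ... | no  none  = ⊥-elim (<-irrefl refl (≤-trans (cherry-bound Gᶜ (proj₂ nc) w∈M w′∈M w≢w′) large))
    where
    M-covered : M - w - w′ ⊆ Nbr₃ Gᶜ u w w′
    M-covered ((z∈M , w≢z) , w′≢z) = inj₁ z∈M , [ u≢M z∈M , [ w≢z , w′≢z ] ]
    disjoint : M - w - w′ ⊥ N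
    disjoint (((z∈M , _) , _) , z∈N) = N⊥M (z∈N , z∈M)
    N-covered : N ⊆ Nbr₃ Gᶜ u w w′
    N-covered {z} z∈N = inj₂ w-or-w′ , [ u≢N z∈N , [ M≢N w∈M z∈N , M≢N w′∈M z∈N ] ]
      where
      w-or-w′ : z ∈ Nbr Gᶜ w ⊎ z ∈ Nbr Gᶜ w′
      w-or-w′ with nbr? G w z | nbr? G w′ z
      ... | no  z∉Nw | _         = inj₁ (complement-Nbr⁺ G (M≢N w∈M z∈N) z∉Nw)
      ... | yes _    | no  z∉Nw′ = inj₂ (complement-Nbr⁺ G (M≢N w′∈M z∈N) z∉Nw′)
      ... | yes z∈Nw | yes z∈Nw′ = contradiction (z , z∈N , z∈Nw , z∈Nw′) none
    large : n ≤ 2 + count (nbr₃? Gᶜ u w w′)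
    large = begin
      n                                        ≤⟨ n≤|N|+|M| ⟩
      count N? + count M?                      ≡⟨ cong (count N? +_) (count-remove₂ M? w∈M w′∈M w≢w′) ⟩
      count N? + (2 + count (M? -? w -? w′))   ≡⟨ +-comm (count N?) _ ⟩
      2 + (count (M? -? w -? w′) + count N?)   ≤⟨ +-monoʳ-≤ 2 (count-disjoint (M? -? w -? w′) N? (nbr₃? Gᶜ u w w′)
                                                                              M-covered N-covered disjoint) ⟩
      2 + count (nbr₃? Gᶜ u w w′)              ∎
      where open ≤-Reasoning

  M-has-another : ∀ {w} → w ∈ M → ∃ λ x → x ∈ M × w ≢ x
  M-has-another {w} w∈M =
    count-witness (M? -? w) (≤-trans (s≤s z≤n) (s≤s⁻¹ (subst (3 ≤_) (count-remove M? w∈M) 3≤|M|)))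

  M-common-neighbour : ∀ {w w′} → w ∈ M → w′ ∈ M → ∃ λ z → z ∈ N × z ∈ Nbr G w × z ∈ Nbr G w′
  M-common-neighbour {w} {w′} w∈M w′∈M with w ≟ w′
  ... | no  w≢w′ = M-pair-common-neighbour w∈M w′∈M w≢w′
  ... | yes refl = case M-has-another w∈M of λ where
    (x , x∈M , w≢x) → case M-pair-common-neighbour w∈M x∈M w≢x of λ where
      (z , z∈N , z∈Nw , _) → z , z∈N , z∈Nw , z∈Nw

  N-M-common-neighbour : ∀ {v w} → v ∈ N → w ∈ M → w ∉ Nbr G v →
                         ∃ λ z → z ∈ N × z ∈ Nbr G v × z ∈ Nbr G w
  N-M-common-neighbour {v} {w} v∈N w∈M w∉Nv with any? (N? ∩? nbr? G v ∩? nbr? G w)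
  ... | yes found = found
  ... | no  none  = ⊥-elim (<-irrefl refl (≤-trans (cherry-bound Gᶜ (proj₂ nc) u∈Nᶜw v∈Nᶜw (u≢N v∈N)) large))
    where
    u∈Nᶜw : u ∈ Nbr Gᶜ w
    u∈Nᶜw = Nbr-sym Gᶜ w∈M
    v∈Nᶜw : v ∈ Nbr Gᶜ w
    v∈Nᶜw = complement-Nbr⁺ G (M≢N w∈M v∈N) (w∉Nv ∘ Nbr-sym G)
    disjoint : N - v ⊥ M - w
    disjoint ((z∈N , _) , (z∈M , _)) = N⊥M (z∈N , z∈M)
    M-covered : M - w ⊆ Nbr₃ Gᶜ w u v
    M-covered (z∈M , w≢z) = inj₂ (inj₁ z∈M) , [ w≢z , [ u≢M z∈M , N≢M v∈N z∈M ] ]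
    N-covered : N - v ⊆ Nbr₃ Gᶜ w u v
    N-covered {z} (z∈N , v≢z) = w-or-v , [ M≢N w∈M z∈N , [ u≢N z∈N , v≢z ] ]
      where
      w-or-v : z ∈ Nbr Gᶜ w ⊎ z ∈ Nbr Gᶜ u ⊎ z ∈ Nbr Gᶜ v
      w-or-v with nbr? G v z | nbr? G w z
      ... | no  z∉Nv | _        = inj₂ (inj₂ (complement-Nbr⁺ G v≢z z∉Nv))
      ... | yes _    | no  z∉Nw = inj₁ (complement-Nbr⁺ G (M≢N w∈M z∈N) z∉Nw)
      ... | yes z∈Nv | yes z∈Nw = contradiction (z , z∈N , z∈Nv , z∈Nw) none
    large : n ≤ 2 + count (nbr₃? Gᶜ w u v)
    large = begin
      n                                              ≤⟨ n≤|N|+|M| ⟩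
      count N? + count M?                            ≡⟨ cong₂ _+_ (count-remove N? v∈N) (count-remove M? w∈M) ⟩
      suc (count (N? -? v)) + suc (count (M? -? w))  ≡⟨ cong suc (+-suc _ _) ⟩
      2 + (count (N? -? v) + count (M? -? w))        ≤⟨ +-monoʳ-≤ 2 (count-disjoint (N? -? v) (M? -? w) (nbr₃? Gᶜ w u v)
                                                                                    N-covered M-covered disjoint) ⟩
      2 + count (nbr₃? Gᶜ w u v)                     ∎
      where open ≤-Reasoning

  small-set-non-neighbour : {S : Pred (Fin (suc n)) ℓ} (S? : Decidable S) → S ⊆ N → count S? ≤ 2 →
                            ∃ λ w → w ∈ M × (∀ {s} → s ∈ S → w ∉ Nbr G s)
  small-set-non-neighbour S? S⊆N |S|≤2 =
    case ⊆-pair S? N? S⊆N |S|≤2 (≤-trans (n≤1+n 2) 3≤|N|) of λ where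
      (a , b , a∈N , b∈N , a≢b , S⊆ab) → case N-pair-common-non-neighbour a∈N b∈N a≢b of λ where
        (w , w∈M , w∉Na , w∉Nb) →
          w , w∈M , λ {s} s∈S → [ (λ { refl → w∉Na }) , (λ { refl → w∉Nb }) ] (S⊆ab s∈S)

  3≤|N∩Nbr| : ∀ {w} → w ∈ M → 3 ≤ count (N? ∩? nbr? G w)
  3≤|N∩Nbr| {w} w∈M with 3 ≤? count (N? ∩? nbr? G w)
  ... | yes large = large
  ... | no  small = case small-set-non-neighbour (N? ∩? nbr? G w) proj₁ (s≤s⁻¹ (≰⇒> small)) of λ where
    (w′ , w′∈M , w′-misses) → case M-common-neighbour w∈M w′∈M of λ where
      (z , z∈N , z∈Nw , z∈Nw′) → contradiction (Nbr-sym G z∈Nw′) (w′-misses (z∈N , z∈Nw))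

  |N∩closedNbr|≤2 : ∀ {v} → v ∈ N → count (N? ∩? nbr? G v) ≤ 1 →
                    count (N? ∩? (nbr? G v ∪? (v ≟_))) ≤ 2
  |N∩closedNbr|≤2 {v} v∈N |N∩Nbr|≤1 = begin
    count S?                     ≡⟨ count-remove S? (v∈N , inj₂ refl) ⟩
    suc (count (S? -? v))        ≤⟨ s≤s (count-mono (S? -? v) (N? ∩? nbr? G v) open-part) ⟩
    suc (count (N? ∩? nbr? G v)) ≤⟨ s≤s |N∩Nbr|≤1 ⟩
    2                            ∎
    where
    open ≤-Reasoning
    S? = N? ∩? (nbr? G v ∪? (v ≟_))
    open-part : N ∩ (Nbr G v ∪ ｛ v ｝) - v ⊆ N ∩ Nbr G v
    open-part ((z∈N , inj₁ z∈Nv) , _)   = z∈N , z∈Nv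
    open-part ((_   , inj₂ v≡z)  , v≢z) = contradiction v≡z v≢z

  2≤|N∩Nbr| : ∀ {v} → v ∈ N → 2 ≤ count (N? ∩? nbr? G v)
  2≤|N∩Nbr| {v} v∈N with 2 ≤? count (N? ∩? nbr? G v)
  ... | yes large = large
  ... | no  small = case small-set-non-neighbour (N? ∩? (nbr? G v ∪? (v ≟_))) proj₁
                                                 (|N∩closedNbr|≤2 v∈N (s≤s⁻¹ (≰⇒> small))) of λ where
    (w , w∈M , w-misses) → case N-M-common-neighbour v∈N w∈M (w-misses (v∈N , inj₂ refl)) of λ where
      (z , z∈N , z∈Nv , z∈Nw) → contradiction (Nbr-sym G z∈Nw) (w-misses (z∈N , inj₁ z∈Nv))

  3+|M∩Nbr|≤deg : ∀ {v} → v ∈ N → 3 + count (M? ∩? nbr? G v) ≤ deg G v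
  3+|M∩Nbr|≤deg {v} v∈N = begin
    3 + count (M? ∩? nbr? G v)
      ≤⟨ s≤s (+-monoˡ-≤ (count (M? ∩? nbr? G v)) (2≤|N∩Nbr| v∈N)) ⟩
    suc (count (N? ∩? nbr? G v) + count (M? ∩? nbr? G v))
      ≤⟨ s≤s (count-disjoint (N? ∩? nbr? G v) (M? ∩? nbr? G v) (nbr? G v -? u) N-part M-part disjoint) ⟩
    suc (count (nbr? G v -? u)) ≡⟨ count-remove (nbr? G v) (Nbr-sym G v∈N) ⟨
    count (nbr? G v)            ≡⟨ deg≡count G v ⟨
    deg G v                     ∎
    where
    open ≤-Reasoning
    disjoint : N ∩ Nbr G v ⊥ M ∩ Nbr G v
    disjoint ((z∈N , _) , (z∈M , _)) = N⊥M (z∈N , z∈M)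
    N-part : N ∩ Nbr G v ⊆ Nbr G v - u
    N-part (z∈N , z∈Nv) = z∈Nv , u≢N z∈N
    M-part : M ∩ Nbr G v ⊆ Nbr G v - u
    M-part (z∈M , z∈Nv) = z∈Nv , u≢M z∈M

  3n≤nbrDegSum : 3 * n ≤ nbrDegSum G u
  3n≤nbrDegSum = begin
    3 * n                                       ≤⟨ *-monoʳ-≤ 3 n≤|N|+|M| ⟩
    3 * (count N? + count M?)                   ≡⟨ *-distribˡ-+ 3 (count N?) (count M?) ⟩
    3 * count N? + 3 * count M?                 ≡⟨ cong₂ _+_ (∑-[]⟨⟩-const N? 3) (∑-[]⟨⟩-const M? 3) ⟨
    ∑N⟨ 3 ⟩ + ∑[ w < suc n ] [ M? w ]⟨ 3 ⟩
      ≤⟨ +-monoʳ-≤ ∑N⟨ 3 ⟩ (∑-mono-≤ (λ w → []⟨⟩-mono (M? w) 3≤|N∩Nbr|)) ⟩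
    ∑N⟨ 3 ⟩ + ∑[ w < suc n ] [ M? w ]⟨ count (N? ∩? nbr? G w) ⟩
      ≡⟨ cong (∑N⟨ 3 ⟩ +_) (edges-between G M? N?) ⟩
    ∑N⟨ 3 ⟩ + ∑[ v < suc n ] [ N? v ]⟨ count (M? ∩? nbr? G v) ⟩
      ≡⟨ ∑-distrib-+ (λ v → [ N? v ]⟨ 3 ⟩) (λ v → [ N? v ]⟨ count (M? ∩? nbr? G v) ⟩) ⟨
    ∑[ v < suc n ] ([ N? v ]⟨ 3 ⟩ + [ N? v ]⟨ count (M? ∩? nbr? G v) ⟩)
      ≤⟨ ∑-mono-≤ (λ v → []⟨⟩-+-mono (N? v) {3} {count (M? ∩? nbr? G v)} 3+|M∩Nbr|≤deg) ⟩
    ∑[ v < suc n ] [ N? v ]⟨ deg G v ⟩          ≡⟨ nbrDegSum≡∑ G u ⟨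
    nbrDegSum G u                               ∎
    where
    open ≤-Reasoning
    ∑N⟨_⟩ : ℕ → ℕ
    ∑N⟨ c ⟩ = ∑[ v < suc n ] [ N? v ]⟨ c ⟩

lemma8 : (G : Graph 14) (u : Fin 14) → deg G u ≡ 6 → NonCompliant3 G → 39 ≤ nbrDegSum G u
lemma8 G u _ nc = 3n≤nbrDegSum G nc u
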